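{- Let $p$ be an odd prime which is a rogue prime and let $i\in\{1,2\}$. Then the rogue sequence $\langle(-1)^{i+1}\rangle_i^p$ has exactly $O_p(2)-1$ terms, and $O_p(2)-1\le\frac{p-3}{2}$. If $\langle g\rangle_i^p$ is a rogue loop in $A_i^p$, then the set of its terms has exactly $O_p(2)$ elements; in particular every rogue loop has length at most $\frac{p-1}{2}$. Finally, the number of distinct (pairwise disjoint) rogue loops in $A_i^p$, i.e. the number of distinct sets that arise as the set of terms of a rogue loop $\langle g\rangle_i^p$, $g\in A_i^p$, is $\frac{p-1}{O_p(2)}-1$.
   Context: $O_p(2)$ denotes the multiplicative order of $2$ in $(\mathbb{Z}/p\mathbb{Z})^\times$. For an odd prime $p$ and $i\in\{1,2\}$, let $A_i^p=(\mathbb{Z}/p\mathbb{Z})^\times\setminus\{(-1)^i \bmod p\}$. For $g\in A_i^p$ define $u_1=g$ and $u_n=2u_{n-1}+(-1)^{i+1}$ in $\mathbb{Z}/p\mathbb{Z}$ for $n>1$; let $g_k^i=\min(\{n\in\mathbb{N}: u_n=0\}\cup\{\infty\})$, and call $\langle g\rangle_i^p=(u_n)_{1\le n<g_k^i}$ the rogue sequence of $g$. A rogue loop is a periodic rogue sequence (one never reaching $0$); its length is the size of its set of terms. $p$ is a rogue prime if for some $j\in\{1,2\}$ some $\langle g\rangle_j^p$ is a rogue loop; equivalently, $2$ is not a primitive root modulo $p$. -}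

module Defs where

open import Data.Nat using (ℕ; zero; suc; _+_; _*_; _∸_; _^_; _<_; _%_)
open import Data.Fin using (Fin)
open import Data.Product using (Σ; _×_; ∃)
open import Relation.Binary.PropositionalEquality using (_≡_; _≢_)
open import Function.Definitions using (Injective)

-- reduction mod p (p is a prime in all uses; the p = 0 case is junk)
_mod_ : ℕ → ℕ → ℕ
x mod zero  = x
x mod suc n = x % suc n

-- Elements of ℤ/pℤ are represented by their canonical residues 0 ≤ x < p.

negOnePow : ℕ → ℕ → ℕ
negOnePow p zero    = 1 mod p
negOnePow p (suc i) = (p ∸ negOnePow p i) mod p

step : ℕ → ℕ → ℕ → ℕ
step i p x = (2 * x + negOnePow p (suc i)) mod p

-- term i p g n  =  u_{n+1}  (so term i p g 0 = u_1 = g)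
term : ℕ → ℕ → ℕ → ℕ → ℕ
term i p g zero    = g
term i p g (suc n) = step i p (term i p g n)

InA : ℕ → ℕ → ℕ → Set
InA i p g = (g < p) × (g ≢ 0) × (g ≢ negOnePow p i)

-- ⟨g⟩_i^p has exactly m terms, i.e. g_k^i = m + 1 (u_{m+1} = 0 and u_n ≠ 0 for 1 ≤ n ≤ m)
NumTerms : ℕ → ℕ → ℕ → ℕ → Set
NumTerms i p g m = (term i p g m ≡ 0) × (∀ n → n < m → term i p g n ≢ 0)

IsLoop : ℕ → ℕ → ℕ → Set
IsLoop i p g = ∀ n → term i p g n ≢ 0

TermOf : ℕ → ℕ → ℕ → ℕ → Set
TermOf i p g x = ∃ λ n → term i p g n ≡ x

HasSize : (ℕ → Set) → ℕ → Set
HasSize P k = Σ (Fin k → ℕ) λ f → Injective _≡_ _≡_ f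
  × (∀ x → P x → ∃ λ j → f j ≡ x) × (∀ j → P (f j))

SameTerms : ℕ → ℕ → ℕ → ℕ → Set
SameTerms i p g h = ∀ x → (TermOf i p g x → TermOf i p h x) × (TermOf i p h x → TermOf i p g x)

NumLoops : ℕ → ℕ → ℕ → Set
NumLoops i p k = Σ (Fin k → ℕ) λ f →
    (∀ j → InA i p (f j) × IsLoop i p (f j))
  × (∀ j j' → SameTerms i p (f j) (f j') → j ≡ j')
  × (∀ g → InA i p g → IsLoop i p g → ∃ λ j → SameTerms i p g (f j))

IsOrd : ℕ → ℕ → Set
IsOrd p o = (0 < o) × ((2 ^ o) mod p ≡ 1) × (∀ m → 0 < m → m < o → (2 ^ m) mod p ≢ 1)

Rogue : ℕ → Set
Rogue p = ∃ λ j → ((j ≡ 1) Data.Sum.⊎ (j ≡ 2)) × ∃ λ g → InA j p g × IsLoop j p g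
  where import Data.Sum

module Submission where

-- Write ε = (-1)^(i+1) and ψ x = 1 + ε x.  Since ε² = 1, ψ conjugates the rogue step
-- u ↦ 2u + ε into doubling, so ψ carries the terms of ⟨g⟩ bijectively onto the orbit of
-- ψ g under multiplication by 2, a coset of the subgroup ⟨2⟩ of (ℤ/pℤ)^×.  The sequence
-- reaches 0 = ψ⁻¹ 1 exactly when this coset is ⟨2⟩ itself; started at ε = ψ⁻¹ 2 it does
-- so after O_p(2) - 1 terms.  So the rogue loops are the other cosets, each of size
-- O_p(2).  Listing the residues as 0 and the 2^n r, with r the least element of a coset,
-- gives p = 1 + (c + 1) O_p(2) for c the number of rogue loops, and a rogue prime has
-- c ≥ 1, whence O_p(2) ≤ (p - 1)/2.

open import Data.Nat
  using (ℕ; zero; suc; _+_; _*_; _∸_; _^_; _≤_; _<_; _%_; _/_; pred; NonZero; z≤n; s≤s; nonTrivial⇒n>1; >-nonZero⁻¹)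
open import Data.Nat.Properties hiding (suc-injective)
open import Data.Nat.DivMod
  using (m%n%n≡m%n; m<n⇒m%n≡m; %-distribˡ-+; %-distribˡ-*; [m+kn]%n≡m%n; m*n%n≡0; m%n<n; m≡m%n+[m/n]*n; m*n/n≡m; /-monoˡ-≤)
open import Data.Nat.Divisibility using (_∣_; m%n≡0⇒n∣m; n∣m⇒m%n≡0)
open import Data.Nat.Primality using (Prime; euclidsLemma; prime⇒nonZero; prime⇒nonTrivial)
open import Data.Nat.Tactic.RingSolver using (solve-∀)
import Algebra.Properties.CommutativeSemigroup as CommutativeSemigroupProperties
open import Data.Product using (_×_; _,_; proj₁; proj₂; ∃; uncurry; map₁)
open import Data.Sum using (_⊎_; inj₁; inj₂)
open import Function using (_∘_)
open import Relation.Nullary using (¬_; contradiction; Dec)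
open import Relation.Nullary.Decidable using (¬?; _×-dec_; map′; decidable-stable)
open import Data.Fin using (Fin; zero; suc; toℕ; fromℕ<; remQuot; combine)
open import Data.Fin.Properties
  using (suc-injective; any?; all?; ¬∀⟶∃¬-smallest; toℕ-fromℕ<; nonZeroIndex; toℕ-inject; toℕ<n; toℕ-injective;
         combine-remQuot; remQuot-combine; cantor-schröder-bernstein)
open import Data.List using (List; length; lookup; filter; upTo)
import Data.List.Relation.Unary.All as All
open import Data.List.Relation.Unary.AllPairs using (_∷_)
open import Data.List.Relation.Unary.Any using (index)
open import Data.List.Relation.Unary.Any.Properties using (lookup-index)
open import Data.List.Membership.Propositional using (_∈_)
open import Data.List.Membership.Propositional.Properties
  using (∈-filter⁻; ∈-filter⁺; ∈-upTo⁻; ∈-upTo⁺; ∈-lookup)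
open import Data.List.Relation.Unary.Unique.Propositional using (Unique)
open import Data.List.Relation.Unary.Unique.Propositional.Properties using (filter⁺; upTo⁺)
open import Function.Definitions using (Injective)
open import Relation.Binary.Bundles using (Setoid)
import Relation.Binary.Reasoning.Setoid as SetoidReasoning
open import Relation.Binary.PropositionalEquality
open import Relation.Binary.Definitions using (tri<; tri≈; tri>)
open import Defs

mod≡% : ∀ x n .{{_ : NonZero n}} → x mod n ≡ x % n
mod≡% x (suc n) = refl

*-pred+ : ∀ m n .{{_ : NonZero n}} → m * pred n + m ≡ m * n
*-pred+ m n = begin
  m * pred n + m    ≡⟨ +-comm (m * pred n) m ⟩
  m + m * pred n    ≡⟨ *-suc m (pred n) ⟨
  m * suc (pred n)  ≡⟨ cong (m *_) (suc-pred n) ⟩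
  m * n             ∎
  where open ≡-Reasoning

m*2≤n⇒m≤n/2 : ∀ {m n} → m * 2 ≤ n → m ≤ n / 2
m*2≤n⇒m≤n/2 {m} {n} m*2≤n = subst (_≤ n / 2) (m*n/n≡m m 2) (/-monoˡ-≤ 2 m*2≤n)

m*2≤n⇒m∸1≤[n∸2]/2 : ∀ {m n} → m * 2 ≤ n → m ∸ 1 ≤ (n ∸ 2) / 2
m*2≤n⇒m∸1≤[n∸2]/2 {m} {n} m*2≤n =
  m*2≤n⇒m≤n/2 (subst (_≤ n ∸ 2) (sym (*-distribʳ-∸ 2 m 1)) (∸-monoˡ-≤ 2 m*2≤n))

m*2≤[1+n]*m : ∀ m {n} → 0 < n → m * 2 ≤ suc n * m
m*2≤[1+n]*m m {n} 0<n = subst (_≤ suc n * m) (*-comm 2 m) (+-monoʳ-≤ m (*-monoˡ-≤ m 0<n))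

order-bounds : ∀ n {c o} → 0 < c → n ∸ 1 ≡ suc c * o → o ≤ (n ∸ 1) / 2 × o ∸ 1 ≤ (n ∸ 3) / 2
order-bounds n {c} {o} 0<c n∸1≡[1+c]*o =
    m*2≤n⇒m≤n/2 o*2≤n∸1
  , subst (λ k → o ∸ 1 ≤ k / 2) (∸-+-assoc n 1 2) (m*2≤n⇒m∸1≤[n∸2]/2 {o} o*2≤n∸1)
  where
    o*2≤n∸1 : o * 2 ≤ n ∸ 1
    o*2≤n∸1 = subst (o * 2 ≤_) (sym n∸1≡[1+c]*o) (m*2≤[1+n]*m o 0<c)

[n∸1]/o∸1≡c : ∀ n {c} o .{{_ : NonZero o}} → n ∸ 1 ≡ suc c * o → (n ∸ 1) / o ∸ 1 ≡ c
[n∸1]/o∸1≡c n {c} o n∸1≡[1+c]*o =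
  trans (cong (λ k → k / o ∸ 1) n∸1≡[1+c]*o) (cong pred (m*n/n≡m (suc c) o))

lookup-injective : ∀ {A : Set} {xs : List A} → Unique xs → ∀ i j → lookup xs i ≡ lookup xs j → i ≡ j
lookup-injective (_ ∷ _)        zero    zero    _ = refl
lookup-injective (x≢xs ∷ _)     zero    (suc j) e = contradiction e (All.lookup x≢xs (∈-lookup j))
lookup-injective (x≢xs ∷ _)     (suc i) zero    e = contradiction (sym e) (All.lookup x≢xs (∈-lookup i))
lookup-injective (_ ∷ xs-uniq)  (suc i) (suc j) e = cong suc (lookup-injective xs-uniq i j e)

enumeration-size : ∀ {n m} (f : Fin n → ℕ) → Injective _≡_ _≡_ f →
                   (∀ j → f j < m) → (∀ x → x < m → ∃ λ j → f j ≡ x) → n ≡ m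
enumeration-size f f-injective f<m f-onto =
  cantor-schröder-bernstein {f = to} {g = from} to-injective from-injective
  where
    to : Fin _ → Fin _
    to j = fromℕ< (f<m j)
    from : Fin _ → Fin _
    from x = proj₁ (f-onto (toℕ x) (toℕ<n x))
    to-injective : Injective _≡_ _≡_ to
    to-injective e = f-injective (trans (sym (toℕ-fromℕ< _)) (trans (cong toℕ e) (toℕ-fromℕ< _)))
    from-injective : Injective _≡_ _≡_ from
    from-injective {x} {y} e = toℕ-injective
      (trans (sym (proj₂ (f-onto (toℕ x) _))) (trans (cong f e) (proj₂ (f-onto (toℕ y) _))))

module +-Props = CommutativeSemigroupProperties +-commutativeSemigroup
module *-Props = CommutativeSemigroupProperties *-commutativeSemigroup

module Congruence (p : ℕ) (prime : Prime p) where

  instance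
    p-nonZero : NonZero p
    p-nonZero = prime⇒nonZero prime

  1<p : 1 < p
  1<p = nonTrivial⇒n>1 p {{prime⇒nonTrivial prime}}

  -- A record, so that x and y can be inferred from a proof of x ≈ y.
  infix 4 _≈_
  record _≈_ (x y : ℕ) : Set where
    constructor congruent
    field residue-≡ : x % p ≡ y % p
  open _≈_ public

  ≈-setoid : Setoid _ _
  ≈-setoid = record
    { Carrier = ℕ
    ; _≈_ = _≈_
    ; isEquivalence = record
      { refl = congruent refl
      ; sym = λ (congruent e) → congruent (sym e)
      ; trans = λ (congruent e) (congruent f) → congruent (trans e f)
      }
    }

  open Setoid ≈-setoid public
    using () renaming (refl to ≈-refl; sym to ≈-sym; trans to ≈-trans; reflexive to ≡⇒≈)
  module ≈-Reasoning = SetoidReasoning ≈-setoid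

  %-≈ : ∀ x → x % p ≈ x
  %-≈ x = congruent (m%n%n≡m%n x p)

  mod-≈ : ∀ x → x mod p ≈ x
  mod-≈ x = ≈-trans (≡⇒≈ (mod≡% x p)) (%-≈ x)

  1mod[p]≡1 : 1 mod p ≡ 1
  1mod[p]≡1 = trans (mod≡% 1 p) (m<n⇒m%n≡m 1<p)

  ≈1⇒mod≡1 : ∀ {x} → x ≈ 1 → x mod p ≡ 1
  ≈1⇒mod≡1 {x} (congruent e) = trans (mod≡% x p) (trans e (m<n⇒m%n≡m 1<p))

  mod≡1⇒≈1 : ∀ {x} → x mod p ≡ 1 → x ≈ 1
  mod≡1⇒≈1 {x} e = ≈-trans (≈-sym (mod-≈ x)) (≡⇒≈ e)

  ≈⇒≡ : ∀ {x y} → x < p → y < p → x ≈ y → x ≡ y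
  ≈⇒≡ x<p y<p (congruent e) = trans (sym (m<n⇒m%n≡m x<p)) (trans e (m<n⇒m%n≡m y<p))

  _≈?_ : ∀ x y → Dec (x ≈ y)
  x ≈? y = map′ congruent residue-≡ (x % p ≟ y % p)

  +-cong : ∀ {a b c d} → a ≈ b → c ≈ d → a + c ≈ b + d
  +-cong {a} {b} {c} {d} (congruent e) (congruent f) = congruent (begin
    (a + c) % p             ≡⟨ %-distribˡ-+ a c p ⟩
    (a % p + c % p) % p     ≡⟨ cong₂ (λ u v → (u + v) % p) e f ⟩
    (b % p + d % p) % p     ≡⟨ %-distribˡ-+ b d p ⟨
    (b + d) % p             ∎)
    where open ≡-Reasoning

  *-cong : ∀ {a b c d} → a ≈ b → c ≈ d → a * c ≈ b * d
  *-cong {a} {b} {c} {d} (congruent e) (congruent f) = congruent (begin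
    (a * c) % p             ≡⟨ %-distribˡ-* a c p ⟩
    (a % p * (c % p)) % p   ≡⟨ cong₂ (λ u v → (u * v) % p) e f ⟩
    (b % p * (d % p)) % p   ≡⟨ %-distribˡ-* b d p ⟨
    (b * d) % p             ∎)
    where open ≡-Reasoning

  +-congˡ : ∀ a {b c} → b ≈ c → a + b ≈ a + c
  +-congˡ a = +-cong (≈-refl {a})

  +-congʳ : ∀ a {b c} → b ≈ c → b + a ≈ c + a
  +-congʳ a b≈c = +-cong b≈c (≈-refl {a})

  *-congˡ : ∀ a {b c} → b ≈ c → a * b ≈ a * c
  *-congˡ a = *-cong (≈-refl {a})

  *-congʳ : ∀ a {b c} → b ≈ c → b * a ≈ c * a
  *-congʳ a b≈c = *-cong b≈c (≈-refl {a})

  +-multiple : ∀ a k → a + k * p ≈ a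
  +-multiple a k = congruent ([m+kn]%n≡m%n a k p)

  p≈0 : p ≈ 0
  p≈0 = ≈-trans (≡⇒≈ (sym (*-identityˡ p))) (+-multiple 0 1)

  neg : ℕ → ℕ
  neg c = c * pred p

  neg-inverse : ∀ c → neg c + c ≈ 0
  neg-inverse c = ≈-trans (≡⇒≈ (*-pred+ c p)) (+-multiple 0 c)

  +-cancelˡ : ∀ c {a b} → c + a ≈ c + b → a ≈ b
  +-cancelˡ c {a} {b} e = begin
    a                   ≈⟨ +-congʳ a (neg-inverse c) ⟨
    (neg c + c) + a     ≡⟨ +-assoc (neg c) c a ⟩
    neg c + (c + a)     ≈⟨ +-congˡ (neg c) e ⟩
    neg c + (c + b)     ≡⟨ +-assoc (neg c) c b ⟨
    (neg c + c) + b     ≈⟨ +-congʳ b (neg-inverse c) ⟩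
    b                   ∎
    where open ≈-Reasoning

  0<p : 0 < p
  0<p = <-trans (s≤s z≤n) 1<p

  1≉0 : ¬ 1 ≈ 0
  1≉0 e = contradiction (≈⇒≡ 1<p 0<p e) λ ()

  Unit : ℕ → Set
  Unit x = ¬ x ≈ 0

  ≈0⇒p∣ : ∀ {x} → x ≈ 0 → p ∣ x
  ≈0⇒p∣ {x} (congruent e) = m%n≡0⇒n∣m x p (trans e (m*n%n≡0 0 p))

  p∣⇒≈0 : ∀ {x} → p ∣ x → x ≈ 0
  p∣⇒≈0 {x} p∣x = congruent (trans (n∣m⇒m%n≡0 x p p∣x) (sym (m*n%n≡0 0 p)))

  residue-unit : ∀ {x} → 0 < x → x < p → Unit x
  residue-unit 0<x x<p e = <-irrefl refl (subst (0 <_) (≈⇒≡ x<p 0<p e) 0<x)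

  no-zero-divisors : ∀ {x y} → Unit x → x * y ≈ 0 → y ≈ 0
  no-zero-divisors {x} {y} ux xy≈0 with euclidsLemma x y prime (≈0⇒p∣ xy≈0)
  ... | inj₁ p∣x = contradiction (p∣⇒≈0 p∣x) ux
  ... | inj₂ p∣y = p∣⇒≈0 p∣y

  *-unit : ∀ {x y} → Unit x → Unit y → Unit (x * y)
  *-unit ux uy xy≈0 = uy (no-zero-divisors ux xy≈0)

  unit-cancel-≤ : ∀ {x a b} → Unit x → b ≤ a → x * a ≈ x * b → a ≈ b
  unit-cancel-≤ {x} {a} {b} ux b≤a e = begin
    a       ≡⟨ m+[n∸m]≡n b≤a ⟨
    b + d   ≈⟨ +-congˡ b (no-zero-divisors ux xd≈0) ⟩
    b + 0   ≡⟨ +-identityʳ b ⟩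
    b       ∎
    where
      open ≈-Reasoning
      d = a ∸ b
      xd≈0 : x * d ≈ 0
      xd≈0 = +-cancelˡ (x * b) (begin
        x * b + x * d   ≡⟨ *-distribˡ-+ x b d ⟨
        x * (b + d)     ≡⟨ cong (x *_) (m+[n∸m]≡n b≤a) ⟩
        x * a           ≈⟨ e ⟩
        x * b           ≡⟨ +-identityʳ (x * b) ⟨
        x * b + 0       ∎)

  unit-cancelˡ : ∀ {x a b} → Unit x → x * a ≈ x * b → a ≈ b
  unit-cancelˡ {a = a} {b} ux e with ≤-total b a
  ... | inj₁ b≤a = unit-cancel-≤ ux b≤a e
  ... | inj₂ a≤b = ≈-sym (unit-cancel-≤ ux a≤b (≈-sym e))

  1+pred[p]≈0 : 1 + pred p ≈ 0
  1+pred[p]≈0 = ≈-trans (≡⇒≈ (suc-pred p)) p≈0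

  square-of-minus-one : ∀ {e} → 1 + e ≈ 0 → e * e ≈ 1
  square-of-minus-one {e} 1+e≈0 = +-cancelˡ e (begin
    e + e * e       ≡⟨ *-suc e e ⟨
    e * (1 + e)     ≈⟨ *-congˡ e 1+e≈0 ⟩
    e * 0           ≡⟨ *-zeroʳ e ⟩
    0               ≈⟨ 1+e≈0 ⟨
    1 + e           ≡⟨ +-comm 1 e ⟩
    e + 1           ∎)
    where open ≈-Reasoning

  module Orbits (a o : ℕ) .{{_ : NonZero o}} (a^o≈1 : a ^ o ≈ 1)
                (a^m≉1 : ∀ m → 0 < m → m < o → ¬ a ^ m ≈ 1) where

    a-unit : Unit a
    a-unit a≈0 = 1≉0 (begin
      1                   ≈⟨ a^o≈1 ⟨
      a ^ o               ≡⟨ cong (a ^_) (suc-pred o) ⟨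
      a * a ^ pred o      ≈⟨ *-congʳ (a ^ pred o) a≈0 ⟩
      0                   ∎)
      where open ≈-Reasoning

    a^n-unit : ∀ n → Unit (a ^ n)
    a^n-unit zero    = 1≉0
    a^n-unit (suc n) = *-unit a-unit (a^n-unit n)

    a^[k*o+n]≈a^n : ∀ k n → a ^ (k * o + n) ≈ a ^ n
    a^[k*o+n]≈a^n zero    n = ≈-refl
    a^[k*o+n]≈a^n (suc k) n = begin
      a ^ (o + k * o + n)       ≡⟨ cong (a ^_) (+-assoc o (k * o) n) ⟩
      a ^ (o + (k * o + n))     ≡⟨ ^-distribˡ-+-* a o (k * o + n) ⟩
      a ^ o * a ^ (k * o + n)   ≈⟨ *-cong a^o≈1 (a^[k*o+n]≈a^n k n) ⟩
      1 * a ^ n                 ≡⟨ *-identityˡ (a ^ n) ⟩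
      a ^ n                     ∎
      where open ≈-Reasoning

    a^n≈a^[n%o] : ∀ n → a ^ n ≈ a ^ (n % o)
    a^n≈a^[n%o] n = begin
      a ^ n                     ≡⟨ cong (a ^_) (trans (m≡m%n+[m/n]*n n o) (+-comm (n % o) (n / o * o))) ⟩
      a ^ (n / o * o + n % o)   ≈⟨ a^[k*o+n]≈a^n (n / o) (n % o) ⟩
      a ^ (n % o)               ∎
      where open ≈-Reasoning

    Orbit : ℕ → ℕ → Set
    Orbit x y = ∃ λ n → y ≈ a ^ n * x

    ≈⇒orbit : ∀ {x y} → x ≈ y → Orbit x y
    ≈⇒orbit {x} x≈y = 0 , ≈-trans (≈-sym x≈y) (≡⇒≈ (sym (*-identityˡ x)))

    orbit-trans : ∀ {x y z} → Orbit x y → Orbit y z → Orbit x z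
    orbit-trans {x} {y} {z} (n , y≈) (m , z≈) = m + n , (begin
      z                   ≈⟨ z≈ ⟩
      a ^ m * y           ≈⟨ *-congˡ (a ^ m) y≈ ⟩
      a ^ m * (a ^ n * x) ≡⟨ *-assoc (a ^ m) (a ^ n) x ⟨
      a ^ m * a ^ n * x   ≡⟨ cong (_* x) (^-distribˡ-+-* a m n) ⟨
      a ^ (m + n) * x     ∎)
      where open ≈-Reasoning

    -- a ^ (n * pred o) inverts a ^ n, because a ^ (n * o) ≈ 1.
    orbit-sym : ∀ {x y} → Orbit x y → Orbit y x
    orbit-sym {x} {y} (n , y≈) = n * pred o , ≈-sym (begin
      a ^ (n * pred o) * y            ≈⟨ *-congˡ (a ^ (n * pred o)) y≈ ⟩
      a ^ (n * pred o) * (a ^ n * x)  ≡⟨ *-assoc (a ^ (n * pred o)) (a ^ n) x ⟨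
      a ^ (n * pred o) * a ^ n * x    ≡⟨ cong (_* x) (^-distribˡ-+-* a (n * pred o) n) ⟨
      a ^ (n * pred o + n) * x        ≡⟨ cong (λ k → a ^ k * x) (*-pred+ n o) ⟩
      a ^ (n * o) * x                 ≡⟨ cong (λ k → a ^ k * x) (+-identityʳ (n * o)) ⟨
      a ^ (n * o + 0) * x             ≈⟨ *-congʳ x (a^[k*o+n]≈a^n n 0) ⟩
      1 * x                           ≡⟨ *-identityˡ x ⟩
      x                               ∎)
      where open ≈-Reasoning

    orbit-exponent< : ∀ {x y} → Orbit x y → ∃ λ n → n < o × y ≈ a ^ n * x
    orbit-exponent< {x} (n , y≈) = n % o , m%n<n n o , ≈-trans y≈ (*-congʳ x (a^n≈a^[n%o] n))

    exponent-injective-≤ : ∀ {x n m} → Unit x → n ≤ m → m < o → a ^ n * x ≈ a ^ m * x → n ≡ m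
    exponent-injective-≤ {x} {n} ux n≤m m<o e with m≤n⇒∃[o]m+o≡n n≤m
    ... | zero  , refl = sym (+-identityʳ n)
    ... | suc d , refl =
      contradiction (≈-sym 1≈a^[1+d]) (a^m≉1 (suc d) (s≤s z≤n) (≤-<-trans (m≤n+m (suc d) n) m<o))
      where
        1≈a^[1+d] : 1 ≈ a ^ suc d
        1≈a^[1+d] = unit-cancelˡ (*-unit (a^n-unit n) ux) (begin
          a ^ n * x * 1             ≡⟨ *-identityʳ (a ^ n * x) ⟩
          a ^ n * x                 ≈⟨ e ⟩
          a ^ (n + suc d) * x       ≡⟨ cong (_* x) (^-distribˡ-+-* a n (suc d)) ⟩
          a ^ n * a ^ suc d * x     ≡⟨ *-Props.xy∙z≈xz∙y (a ^ n) (a ^ suc d) x ⟩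
          a ^ n * x * a ^ suc d     ∎)
          where open ≈-Reasoning

    exponent-injective : ∀ {x n m} → Unit x → n < o → m < o → a ^ n * x ≈ a ^ m * x → n ≡ m
    exponent-injective {n = n} {m} ux n<o m<o e with ≤-total n m
    ... | inj₁ n≤m = exponent-injective-≤ ux n≤m m<o e
    ... | inj₂ m≤n = sym (exponent-injective-≤ ux m≤n n<o (≈-sym e))

    orbit? : ∀ x y → Dec (Orbit x y)
    orbit? x y = map′ (λ (k , e) → toℕ k , e) bounded (any? λ k → y ≈? (a ^ toℕ k * x))
      where
        bounded : Orbit x y → ∃ λ (k : Fin o) → y ≈ a ^ toℕ k * x
        bounded orb with orbit-exponent< orb
        ... | n , n<o , e = fromℕ< n<o , subst (λ m → y ≈ a ^ m * x) (sym (toℕ-fromℕ< n<o)) e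

    IsLeast : ℕ → Set
    IsLeast r = ∀ (y : Fin r) → ¬ Orbit r (toℕ y)

    orbit-meets-residues : ∀ x → ¬ (∀ (y : Fin p) → ¬ Orbit x (toℕ y))
    orbit-meets-residues x none =
      none (fromℕ< (m%n<n x p)) (≈⇒orbit (≈-trans (≈-sym (%-≈ x)) (≡⇒≈ (sym (toℕ-fromℕ< _)))))

    least-in-orbit : ∀ x → ∃ λ r → r < p × IsLeast r × Orbit r x
    least-in-orbit x
      with ¬∀⟶∃¬-smallest p (λ y → ¬ Orbit x (toℕ y)) (λ y → ¬? (orbit? x (toℕ y)))
                           (orbit-meets-residues x)
    ... | r , ¬¬x~r , smaller = toℕ r , toℕ<n r , least , orbit-sym x~r
      where
        x~r : Orbit x (toℕ r)
        x~r = decidable-stable (orbit? x (toℕ r)) ¬¬x~r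
        least : IsLeast (toℕ r)
        least y r~y = smaller y (orbit-trans x~r (subst (Orbit (toℕ r)) (sym (toℕ-inject y)) r~y))

    least-unique : ∀ {r s} → IsLeast r → IsLeast s → Orbit r s → r ≡ s
    least-unique {r} {s} r-least s-least r~s with <-cmp r s
    ... | tri≈ _ r≡s _ = r≡s
    ... | tri< r<s _ _ =
      contradiction (subst (Orbit s) (sym (toℕ-fromℕ< r<s)) (orbit-sym r~s)) (s-least (fromℕ< r<s))
    ... | tri> _ _ s<r =
      contradiction (subst (Orbit r) (sym (toℕ-fromℕ< s<r)) r~s) (r-least (fromℕ< s<r))

    1-least : IsLeast 1
    1-least zero (n , 0≈a^n*1) = a^n-unit n (≈-sym (≈-trans 0≈a^n*1 (≡⇒≈ (*-identityʳ (a ^ n)))))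

    NontrivialRep : ℕ → Set
    NontrivialRep r = 2 ≤ r × IsLeast r

    nontrivialRep? : ∀ r → Dec (NontrivialRep r)
    nontrivialRep? r = 2 ≤? r ×-dec all? (λ y → ¬? (orbit? r (toℕ y)))

    -- Opaque, so that the type checker never attempts to evaluate the filter.
    opaque
      nontrivialReps : List ℕ
      nontrivialReps = filter nontrivialRep? (upTo p)

      nontrivialReps-unique : Unique nontrivialReps
      nontrivialReps-unique = filter⁺ nontrivialRep? (upTo⁺ p)

      nontrivialRep-lookup : ∀ j → lookup nontrivialReps j < p × NontrivialRep (lookup nontrivialReps j)
      nontrivialRep-lookup j = map₁ ∈-upTo⁻ (∈-filter⁻ nontrivialRep? {xs = upTo p} (∈-lookup j))

      nontrivialRep-index : ∀ {r} → r < p → NontrivialRep r → ∃ λ j → lookup nontrivialReps j ≡ r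
      nontrivialRep-index {r} r<p nontrivial = index r∈ , sym (lookup-index {P = r ≡_} r∈)
        where
          r∈ : r ∈ nontrivialReps
          r∈ = ∈-filter⁺ nontrivialRep? (∈-upTo⁺ r<p) nontrivial

    nontrivialOrbits : ℕ
    nontrivialOrbits = length nontrivialReps

    -- Index zero stands for the orbit of 1, the subgroup generated by a.
    rep : Fin (suc nontrivialOrbits) → ℕ
    rep zero    = 1
    rep (suc j) = lookup nontrivialReps j

    rep-least : ∀ j → IsLeast (rep j)
    rep-least zero    = 1-least
    rep-least (suc j) = proj₂ (proj₂ (nontrivialRep-lookup j))

    rep-unit : ∀ j → Unit (rep j)
    rep-unit zero    = 1≉0
    rep-unit (suc j) with nontrivialRep-lookup j
    ... | r<p , 2≤r , _ = residue-unit (<-trans (s≤s z≤n) 2≤r) r<p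

    rep-injective : Injective _≡_ _≡_ rep
    rep-injective {zero}  {zero}  _ = refl
    rep-injective {zero}  {suc k} e = contradiction (sym e) (>⇒≢ (proj₁ (proj₂ (nontrivialRep-lookup k))))
    rep-injective {suc j} {zero}  e = contradiction e (>⇒≢ (proj₁ (proj₂ (nontrivialRep-lookup j))))
    rep-injective {suc j} {suc k} e = cong suc (lookup-injective nontrivialReps-unique j k e)

    rep-orbit-injective : ∀ {j k} → Orbit (rep j) (rep k) → j ≡ k
    rep-orbit-injective {j} {k} j~k = rep-injective (least-unique (rep-least j) (rep-least k) j~k)

    least-rep : ∀ {r x} → r < p → IsLeast r → Orbit r x → Unit x → ∃ λ j → Orbit (rep j) x
    least-rep {zero}          _   _       (n , x≈) x-unit =
      contradiction (≈-trans x≈ (≡⇒≈ (*-zeroʳ (a ^ n)))) x-unit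
    least-rep {suc zero}      _   _       1~x      _      = zero , 1~x
    least-rep {suc (suc r)} {x} r<p r-least r~x    _
      with nontrivialRep-index r<p (s≤s (s≤s z≤n) , r-least)
    ... | j , j≡r = suc j , subst (λ s → Orbit s x) (sym j≡r) r~x

    orbit-rep : ∀ {x} → Unit x → ∃ λ j → Orbit (rep j) x
    orbit-rep {x} x-unit =
      let (r , r<p , r-least , r~x) = least-in-orbit x in least-rep r<p r-least r~x x-unit

    orbitElement : Fin (suc nontrivialOrbits) × Fin o → ℕ
    orbitElement (j , n) = (a ^ toℕ n * rep j) % p

    orbitElement-injective : Injective _≡_ _≡_ orbitElement
    orbitElement-injective {j , n} {k , m} e = cong₂ _,_ j≡k (toℕ-injective n≡m)
      where
        j≡k : j ≡ k
        j≡k = rep-orbit-injective (orbit-trans (toℕ n , ≈-refl) (orbit-sym (toℕ m , congruent e)))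
        n≡m : toℕ n ≡ toℕ m
        n≡m = exponent-injective (rep-unit j) (toℕ<n n) (toℕ<n m)
                (subst (λ i → a ^ toℕ n * rep j ≈ a ^ toℕ m * rep i) (sym j≡k) (congruent e))

    orbitElement-positive : ∀ jn → 0 < orbitElement jn
    orbitElement-positive (j , n) = n≢0⇒n>0 λ e →
      *-unit (a^n-unit (toℕ n)) (rep-unit j) (≈-trans (≈-sym (%-≈ _)) (≡⇒≈ e))

    orbitElement-onto : ∀ x → 0 < x → x < p → ∃ λ jn → orbitElement jn ≡ x
    orbitElement-onto x 0<x x<p =
      let (j , j~x) = orbit-rep (residue-unit 0<x x<p)
          (n , n<o , x≈) = orbit-exponent< j~x
          x≈' = subst (λ m → x ≈ a ^ m * rep j) (sym (toℕ-fromℕ< n<o)) x≈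
      in (j , fromℕ< n<o) , ≈⇒≡ (m%n<n _ p) x<p (≈-trans (%-≈ _) (≈-sym x≈'))

    residues : Fin (suc (suc nontrivialOrbits * o)) → ℕ
    residues zero    = 0
    residues (suc k) = orbitElement (remQuot o k)

    residues-injective : Injective _≡_ _≡_ residues
    residues-injective {zero}  {zero}   _ = refl
    residues-injective {zero}  {suc k}  e = contradiction (sym e) (>⇒≢ (orbitElement-positive (remQuot o k)))
    residues-injective {suc k} {zero}   e = contradiction e (>⇒≢ (orbitElement-positive (remQuot o k)))
    residues-injective {suc k} {suc k'} e = cong suc (begin
      k                                 ≡⟨ combine-remQuot {suc nontrivialOrbits} o k ⟨
      uncurry combine (remQuot o k)     ≡⟨ cong (uncurry combine) (orbitElement-injective {remQuot o k} {remQuot o k'} e) ⟩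
      uncurry combine (remQuot o k')    ≡⟨ combine-remQuot {suc nontrivialOrbits} o k' ⟩
      k'                                ∎)
      where open ≡-Reasoning

    residues<p : ∀ k → residues k < p
    residues<p zero    = 0<p
    residues<p (suc k) = m%n<n _ p

    residues-onto : ∀ x → x < p → ∃ λ k → residues k ≡ x
    residues-onto zero    _   = zero , refl
    residues-onto (suc x) x<p =
      let ((j , n) , e) = orbitElement-onto (suc x) (s≤s z≤n) x<p
      in suc (combine j n) , trans (cong orbitElement (remQuot-combine j n)) e

    orbits-partition : suc (suc nontrivialOrbits * o) ≡ p
    orbits-partition = enumeration-size residues residues-injective residues<p residues-onto

  pred[p]<p : pred p < p
  pred[p]<p = subst (pred p <_) (suc-pred p) ≤-refl

  p∸1≡pred[p] : p ∸ 1 ≡ pred p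
  p∸1≡pred[p] = cong (_∸ 1) (sym (suc-pred p))

  [p∸1]mod[p]≡pred[p] : (p ∸ 1) mod p ≡ pred p
  [p∸1]mod[p]≡pred[p] = trans (mod≡% (p ∸ 1) p) (trans (cong (_% p) p∸1≡pred[p]) (m<n⇒m%n≡m pred[p]<p))

  [p∸pred[p]]mod[p]≡1 : (p ∸ pred p) mod p ≡ 1
  [p∸pred[p]]mod[p]≡1 = begin
    (p ∸ pred p) mod p              ≡⟨ cong (λ x → (x ∸ pred p) mod p) (suc-pred p) ⟨
    (1 + pred p ∸ pred p) mod p     ≡⟨ cong (_mod p) (m+n∸n≡m 1 (pred p)) ⟩
    1 mod p                         ≡⟨ 1mod[p]≡1 ⟩
    1                               ∎
    where open ≡-Reasoning

  negOnePow-suc : ∀ i {x y} → negOnePow p i ≡ x → (p ∸ x) mod p ≡ y → negOnePow p (suc i) ≡ y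
  negOnePow-suc i e = trans (cong (λ x → (p ∸ x) mod p) e)

  negOnePow-alternates : ∀ i → (negOnePow p i ≡ 1 × negOnePow p (suc i) ≡ pred p)
                             ⊎ (negOnePow p i ≡ pred p × negOnePow p (suc i) ≡ 1)
  negOnePow-alternates zero = inj₁ (1mod[p]≡1 , negOnePow-suc 0 1mod[p]≡1 [p∸1]mod[p]≡pred[p])
  negOnePow-alternates (suc i) with negOnePow-alternates i
  ... | inj₁ (_ , next≡pred[p]) = inj₂ (next≡pred[p] , negOnePow-suc (suc i) next≡pred[p] [p∸pred[p]]mod[p]≡1)
  ... | inj₂ (_ , next≡1)       = inj₁ (next≡1 , negOnePow-suc (suc i) next≡1 [p∸1]mod[p]≡pred[p])

  module RogueSequence (i : ℕ) where

    ε ν : ℕ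
    ε = negOnePow p (suc i)
    ν = negOnePow p i

    ε<p : ε < p
    ε<p with negOnePow-alternates i
    ... | inj₁ (_ , ε≡pred[p]) = subst (_< p) (sym ε≡pred[p]) pred[p]<p
    ... | inj₂ (_ , ε≡1)       = subst (_< p) (sym ε≡1) 1<p

    ν<p : ν < p
    ν<p with negOnePow-alternates i
    ... | inj₁ (ν≡1 , _)       = subst (_< p) (sym ν≡1) 1<p
    ... | inj₂ (ν≡pred[p] , _) = subst (_< p) (sym ν≡pred[p]) pred[p]<p

    ε*ε≈1 : ε * ε ≈ 1
    ε*ε≈1 with negOnePow-alternates i
    ... | inj₁ (_ , ε≡pred[p]) =
      subst (λ e → e * e ≈ 1) (sym ε≡pred[p]) (square-of-minus-one 1+pred[p]≈0)
    ... | inj₂ (_ , ε≡1)       = subst (λ e → e * e ≈ 1) (sym ε≡1) ≈-refl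

    1+ε*ν≈0 : 1 + ε * ν ≈ 0
    1+ε*ν≈0 with negOnePow-alternates i
    ... | inj₁ (ν≡1 , ε≡pred[p]) = subst₂ (λ e n → 1 + e * n ≈ 0) (sym ε≡pred[p]) (sym ν≡1)
                                     (≈-trans (≡⇒≈ (cong suc (*-identityʳ (pred p)))) 1+pred[p]≈0)
    ... | inj₂ (ν≡pred[p] , ε≡1) = subst₂ (λ e n → 1 + e * n ≈ 0) (sym ε≡1) (sym ν≡pred[p])
                                     (≈-trans (≡⇒≈ (cong suc (*-identityˡ (pred p)))) 1+pred[p]≈0)

    ψ : ℕ → ℕ
    ψ x = 1 + ε * x

    ψ⁻¹ : ℕ → ℕ
    ψ⁻¹ y = ε * (y + pred p)

    ψ-cong : ∀ {x y} → x ≈ y → ψ x ≈ ψ y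
    ψ-cong x≈y = +-congˡ 1 (*-congˡ ε x≈y)

    ψ⁻¹-cong : ∀ {x y} → x ≈ y → ψ⁻¹ x ≈ ψ⁻¹ y
    ψ⁻¹-cong x≈y = *-congˡ ε (+-congʳ (pred p) x≈y)

    ψ-ψ⁻¹ : ∀ y → ψ (ψ⁻¹ y) ≈ y
    ψ-ψ⁻¹ y = begin
      1 + ε * (ε * (y + pred p))    ≡⟨ cong suc (*-assoc ε ε (y + pred p)) ⟨
      1 + ε * ε * (y + pred p)      ≈⟨ +-congˡ 1 (*-congʳ (y + pred p) ε*ε≈1) ⟩
      1 + 1 * (y + pred p)          ≡⟨ cong suc (*-identityˡ (y + pred p)) ⟩
      1 + (y + pred p)              ≡⟨ +-Props.x∙yz≈y∙xz 1 y (pred p) ⟩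
      y + (1 + pred p)              ≈⟨ +-congˡ y 1+pred[p]≈0 ⟩
      y + 0                         ≡⟨ +-identityʳ y ⟩
      y                             ∎
      where open ≈-Reasoning

    ψ⁻¹-ψ : ∀ x → ψ⁻¹ (ψ x) ≈ x
    ψ⁻¹-ψ x = begin
      ε * (1 + ε * x + pred p)      ≡⟨ cong (ε *_) (+-Props.xy∙z≈xz∙y 1 (ε * x) (pred p)) ⟩
      ε * (1 + pred p + ε * x)      ≈⟨ *-congˡ ε (+-congʳ (ε * x) 1+pred[p]≈0) ⟩
      ε * (ε * x)                   ≡⟨ *-assoc ε ε x ⟨
      ε * ε * x                     ≈⟨ *-congʳ x ε*ε≈1 ⟩
      1 * x                         ≡⟨ *-identityˡ x ⟩
      x                             ∎
      where open ≈-Reasoning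

    ψ-injective : ∀ {x y} → x < p → y < p → ψ x ≈ ψ y → x ≡ y
    ψ-injective {x} {y} x<p y<p ψx≈ψy = ≈⇒≡ x<p y<p (begin
      x             ≈⟨ ψ⁻¹-ψ x ⟨
      ψ⁻¹ (ψ x)     ≈⟨ ψ⁻¹-cong ψx≈ψy ⟩
      ψ⁻¹ (ψ y)     ≈⟨ ψ⁻¹-ψ y ⟩
      y             ∎)
      where open ≈-Reasoning

    ψ-step : ∀ x → ψ (step i p x) ≈ 2 * ψ x
    ψ-step x = begin
      1 + ε * ((2 * x + ε) mod p)   ≈⟨ ψ-cong (mod-≈ (2 * x + ε)) ⟩
      1 + ε * (2 * x + ε)           ≡⟨ expand ε x ⟩
      1 + ε * ε + 2 * (ε * x)       ≈⟨ +-congʳ (2 * (ε * x)) (+-congˡ 1 ε*ε≈1) ⟩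
      1 + 1 + 2 * (ε * x)           ≡⟨ *-distribˡ-+ 2 1 (ε * x) ⟨
      2 * (1 + ε * x)               ∎
      where
        open ≈-Reasoning
        expand : ∀ e x → 1 + e * (2 * x + e) ≡ 1 + e * e + 2 * (e * x)
        expand = solve-∀

    term<p : ∀ {g} n → g < p → term i p g n < p
    term<p zero    g<p = g<p
    term<p (suc n) _   = subst (_< p) (sym (mod≡% _ p)) (m%n<n _ p)

    ψ-term : ∀ g n → ψ (term i p g n) ≈ 2 ^ n * ψ g
    ψ-term g zero    = ≡⇒≈ (sym (*-identityˡ (ψ g)))
    ψ-term g (suc n) = begin
      ψ (step i p (term i p g n))   ≈⟨ ψ-step (term i p g n) ⟩
      2 * ψ (term i p g n)          ≈⟨ *-congˡ 2 (ψ-term g n) ⟩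
      2 * (2 ^ n * ψ g)             ≡⟨ *-assoc 2 (2 ^ n) (ψ g) ⟨
      2 ^ suc n * ψ g               ∎
      where open ≈-Reasoning

    ψ0≡1 : ψ 0 ≡ 1
    ψ0≡1 = cong suc (*-zeroʳ ε)

    ψε≈2 : ψ ε ≈ 2
    ψε≈2 = +-congˡ 1 ε*ε≈1

    term≡0⇒ : ∀ {g} n → term i p g n ≡ 0 → 2 ^ n * ψ g ≈ 1
    term≡0⇒ {g} n e = ≈-trans (≈-sym (ψ-term g n)) (≡⇒≈ (trans (cong ψ e) ψ0≡1))

    ⇒term≡0 : ∀ {g} n → g < p → 2 ^ n * ψ g ≈ 1 → term i p g n ≡ 0
    ⇒term≡0 {g} n g<p e =
      ψ-injective (term<p n g<p) 0<p (≈-trans (ψ-term g n) (≈-trans e (≡⇒≈ (sym ψ0≡1))))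

    module Ordered (o : ℕ) .{{_ : NonZero o}} (2^o≈1 : 2 ^ o ≈ 1)
                   (2^m≉1 : ∀ m → 0 < m → m < o → ¬ 2 ^ m ≈ 1) where

      open Orbits 2 o 2^o≈1 2^m≉1

      numTerms-ε : NumTerms i p ε (o ∸ 1)
      numTerms-ε = ⇒term≡0 (o ∸ 1) ε<p 2^[o∸1]*ψε≈1 , nonzero-before
        where
          1+[o∸1]≡o : suc (o ∸ 1) ≡ o
          1+[o∸1]≡o = m+[n∸m]≡n (>-nonZero⁻¹ o)
          2^n*ψε≈2^[1+n] : ∀ n → 2 ^ n * ψ ε ≈ 2 ^ suc n
          2^n*ψε≈2^[1+n] n = ≈-trans (*-congˡ (2 ^ n) ψε≈2) (≡⇒≈ (*-comm (2 ^ n) 2))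
          2^[o∸1]*ψε≈1 : 2 ^ (o ∸ 1) * ψ ε ≈ 1
          2^[o∸1]*ψε≈1 = ≈-trans (2^n*ψε≈2^[1+n] (o ∸ 1)) (subst (λ k → 2 ^ k ≈ 1) (sym 1+[o∸1]≡o) 2^o≈1)
          nonzero-before : ∀ n → n < o ∸ 1 → term i p ε n ≢ 0
          nonzero-before n n<o∸1 e = 2^m≉1 (suc n) (s≤s z≤n) (subst (suc n <_) 1+[o∸1]≡o (s≤s n<o∸1))
                                       (≈-trans (≈-sym (2^n*ψε≈2^[1+n] n)) (term≡0⇒ n e))

      ψ-unit : ∀ {g} → InA i p g → Unit (ψ g)
      ψ-unit {g} (g<p , _ , g≢ν) ψg≈0 = g≢ν (ψ-injective g<p ν<p (≈-trans ψg≈0 (≈-sym 1+ε*ν≈0)))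

      termSet-size : ∀ {g} → InA i p g → HasSize (TermOf i p g) o
      termSet-size {g} g∈A@(g<p , _) = nthTerm , nthTerm-injective , covers , (λ j → toℕ j , refl)
        where
          nthTerm : Fin o → ℕ
          nthTerm j = term i p g (toℕ j)
          nthTerm-injective : Injective _≡_ _≡_ nthTerm
          nthTerm-injective {j} {k} e = toℕ-injective (exponent-injective (ψ-unit g∈A) (toℕ<n j) (toℕ<n k)
            (≈-trans (≈-sym (ψ-term g (toℕ j))) (≈-trans (≡⇒≈ (cong ψ e)) (ψ-term g (toℕ k)))))
          covers : ∀ x → TermOf i p g x → ∃ λ j → nthTerm j ≡ x
          covers x (n , refl) = fromℕ< (m%n<n n o) , trans (cong (term i p g) (toℕ-fromℕ< (m%n<n n o)))
            (ψ-injective (term<p (n % o) g<p) (term<p n g<p) (begin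
              ψ (term i p g (n % o))    ≈⟨ ψ-term g (n % o) ⟩
              2 ^ (n % o) * ψ g         ≈⟨ *-congʳ (ψ g) (a^n≈a^[n%o] n) ⟨
              2 ^ n * ψ g               ≈⟨ ψ-term g n ⟨
              ψ (term i p g n)          ∎))
            where open ≈-Reasoning

      term-orbit : ∀ g n → Orbit (ψ g) (ψ (term i p g n))
      term-orbit g n = n , ψ-term g n

      orbit-terms : ∀ {g h x} → g < p → h < p → Orbit (ψ g) (ψ h) → TermOf i p h x → TermOf i p g x
      orbit-terms {g} {h} g<p h<p g~h (n , refl) =
        let (k , e) = orbit-trans g~h (term-orbit h n)
        in k , ψ-injective (term<p k g<p) (term<p n h<p) (≈-trans (ψ-term g k) (≈-sym e))

      orbit-sameTerms : ∀ {g h} → g < p → h < p → Orbit (ψ g) (ψ h) → SameTerms i p g h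
      orbit-sameTerms g<p h<p g~h x = orbit-terms h<p g<p (orbit-sym g~h) , orbit-terms g<p h<p g~h

      loop⇒∉orbit[1] : ∀ {g} → g < p → IsLoop i p g → ¬ Orbit 1 (ψ g)
      loop⇒∉orbit[1] g<p loop 1~ψg =
        let (n , 1≈) = orbit-sym 1~ψg in loop n (⇒term≡0 n g<p (≈-sym 1≈))

      ∉orbit[1]⇒loop : ∀ {g} → ¬ Orbit 1 (ψ g) → IsLoop i p g
      ∉orbit[1]⇒loop 1≁ψg n e = 1≁ψg (orbit-sym (n , ≈-sym (term≡0⇒ n e)))

      loop-rep : ∀ {g} → InA i p g → IsLoop i p g → ∃ λ j → Orbit (rep (suc j)) (ψ g)
      loop-rep {g} g∈A@(g<p , _) loop = nontrivial (orbit-rep (ψ-unit g∈A))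
        where
          nontrivial : (∃ λ j → Orbit (rep j) (ψ g)) → ∃ λ j → Orbit (rep (suc j)) (ψ g)
          nontrivial (zero  , 1~ψg) = contradiction 1~ψg (loop⇒∉orbit[1] g<p loop)
          nontrivial (suc j , j~ψg) = j , j~ψg

      loopSeed : Fin nontrivialOrbits → ℕ
      loopSeed j = ψ⁻¹ (rep (suc j)) % p

      ψ-loopSeed : ∀ j → ψ (loopSeed j) ≈ rep (suc j)
      ψ-loopSeed j = ≈-trans (ψ-cong (%-≈ _)) (ψ-ψ⁻¹ _)

      loopSeed<p : ∀ j → loopSeed j < p
      loopSeed<p j = m%n<n _ p

      rep≡ψ-loopSeed : ∀ j {x} → x < p → ψ (loopSeed j) ≈ x → rep (suc j) ≡ x
      rep≡ψ-loopSeed j x<p ψs≈x = ≈⇒≡ (proj₁ (nontrivialRep-lookup j)) x<p (≈-trans (≈-sym (ψ-loopSeed j)) ψs≈x)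

      loopSeed-inA : ∀ j → InA i p (loopSeed j)
      loopSeed-inA j = loopSeed<p j , loopSeed≢0 , loopSeed≢ν
        where
          2≤r : 2 ≤ rep (suc j)
          2≤r = proj₁ (proj₂ (nontrivialRep-lookup j))
          loopSeed≢0 : loopSeed j ≢ 0
          loopSeed≢0 e = >⇒≢ 2≤r (rep≡ψ-loopSeed j 1<p (≡⇒≈ (trans (cong ψ e) ψ0≡1)))
          loopSeed≢ν : loopSeed j ≢ ν
          loopSeed≢ν e = >⇒≢ (<-trans (s≤s z≤n) 2≤r) (rep≡ψ-loopSeed j 0<p (≈-trans (≡⇒≈ (cong ψ e)) 1+ε*ν≈0))

      loopSeed-loop : ∀ j → IsLoop i p (loopSeed j)
      loopSeed-loop j = ∉orbit[1]⇒loop λ 1~ψs →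
        contradiction (rep-orbit-injective {zero} {suc j} (orbit-trans 1~ψs (≈⇒orbit (ψ-loopSeed j)))) λ ()

      numLoops : NumLoops i p nontrivialOrbits
      numLoops = loopSeed , (λ j → loopSeed-inA j , loopSeed-loop j) , distinct , covers
        where
          distinct : ∀ j k → SameTerms i p (loopSeed j) (loopSeed k) → j ≡ k
          distinct j k same =
            let (n , e) = proj₁ (same (loopSeed j)) (0 , refl)
                k~j : Orbit (rep (suc k)) (rep (suc j))
                k~j = orbit-trans (orbit-sym (≈⇒orbit (ψ-loopSeed k)))
                        (orbit-trans (subst (Orbit (ψ (loopSeed k))) (cong ψ e) (term-orbit (loopSeed k) n))
                                     (≈⇒orbit (ψ-loopSeed j)))
            in sym (suc-injective (rep-orbit-injective k~j))
          covers : ∀ g → InA i p g → IsLoop i p g → ∃ λ j → SameTerms i p g (loopSeed j)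
          covers g g∈A@(g<p , _) loop =
            let (j , j~ψg) = loop-rep g∈A loop
            in j , orbit-sameTerms g<p (loopSeed<p j)
                     (orbit-trans (orbit-sym j~ψg) (≈⇒orbit (≈-sym (ψ-loopSeed j))))

mainTheorem8 : (p i : ℕ) → Prime p → p % 2 ≡ 1 → Rogue p → (i ≡ 1 ⊎ i ≡ 2) →
    (o : ℕ) → .{{_ : NonZero o}} → IsOrd p o →
      NumTerms i p (negOnePow p (suc i)) (o ∸ 1)
      × (o ∸ 1 ≤ (p ∸ 3) / 2)
      × (∀ g → InA i p g → IsLoop i p g → HasSize (TermOf i p g) o × o ≤ (p ∸ 1) / 2)
      × NumLoops i p ((p ∸ 1) / o ∸ 1)
mainTheorem8 p i p-prime _ (j , _ , g₀ , g₀∈A , g₀-loop) _ o (_ , 2^o≡1 , 2^m≢1) =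
    numTerms-ε , proj₂ bounds , (λ g g∈A _ → termSet-size g∈A , proj₁ bounds)
  , subst (NumLoops i p) (sym ([n∸1]/o∸1≡c p o p∸1≡[1+c]*o)) numLoops
  where
    open Congruence p p-prime
    2^o≈1 : 2 ^ o ≈ 1
    2^o≈1 = mod≡1⇒≈1 2^o≡1
    2^m≉1 : ∀ m → 0 < m → m < o → ¬ 2 ^ m ≈ 1
    2^m≉1 m 0<m m<o = 2^m≢1 m 0<m m<o ∘ ≈1⇒mod≡1
    open Orbits 2 o 2^o≈1 2^m≉1
    open RogueSequence.Ordered i o 2^o≈1 2^m≉1
    p∸1≡[1+c]*o : p ∸ 1 ≡ suc nontrivialOrbits * o
    p∸1≡[1+c]*o = trans p∸1≡pred[p] (cong pred (sym orbits-partition))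
    rogueOrbit : Fin nontrivialOrbits
    rogueOrbit = proj₁ (RogueSequence.Ordered.loop-rep j o 2^o≈1 2^m≉1 g₀∈A g₀-loop)
    bounds : o ≤ (p ∸ 1) / 2 × o ∸ 1 ≤ (p ∸ 3) / 2
    bounds = order-bounds p (>-nonZero⁻¹ _ {{nonZeroIndex rogueOrbit}}) p∸1≡[1+c]*o
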